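{- If $n_1,n_2,\dots,n_k$ are positive integers such that for no $i\ne j$ we have $n_i\mid n_j$, then $$ m(n_1n_2\cdots n_k)\ge k!\cdot m(n_1)m(n_2)\cdots m(n_k). $$ Moreover, for every $n\ge 1$ we have $$ m(n)\ge \omega(n)!\cdot 2^{\Omega(n)-\omega(n)}\quad\text{and}\quad m(n)\ge 2^{\Omega(n)-1}. $$
   Context: For an integer $n\ge 2$, $m(n)$ denotes the number of ordered factorizations of $n$ into factors larger than $1$, i.e. the number of finite sequences $(d_1,\dots,d_r)$, $r\ge 1$, of integers $d_i\ge 2$ with $d_1\cdots d_r=n$; we use the convention $m(1)=1$. $\omega(n)$ is the number of distinct prime factors of $n$ and $\Omega(n)$ the number of prime factors counted with multiplicity. -}

module Defs where

open import Data.Nat using (ℕ; zero; suc; _+_; _≟_; _≤_; NonZero)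
open import Data.Nat.Divisibility using (_∣?_)
open import Data.Nat.Primality using (prime?)
open import Data.Nat.Primality.Factorisation using (factorise; factors)
open import Data.List using (List; []; _∷_; map; concatMap; filter; length; applyUpTo)
open import Data.Nat.ListAction using (product)
open import Relation.Nullary.Decidable using (_×-dec_)
import Data.Fin
import Data.Nat

listsOfLength : ℕ → List ℕ → List (List ℕ)
listsOfLength zero    xs = [] ∷ []
listsOfLength (suc r) xs = concatMap (λ d → map (d ∷_) (listsOfLength r xs)) xs

from2to : ℕ → List ℕ
from2to n = filter (λ d → 2 Data.Nat.≤? d) (applyUpTo (λ i → i) (suc n))

-- Every ordered factorization of n ≥ 2 into factors ≥ 2 is among them,
-- since each factor is ≤ n and r ≤ log₂ n ≤ n; no list occurs twice.
candidates : ℕ → List (List ℕ)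
candidates n = concatMap (λ r → listsOfLength (suc r) (from2to n)) (applyUpTo (λ i → i) n)

orderedFactorizations : ℕ → List (List ℕ)
orderedFactorizations n = filter (λ l → product l ≟ n) (candidates n)

m : ℕ → ℕ
m 1 = 1
m n = length (orderedFactorizations n)

ω : ℕ → ℕ
ω n = length (filter (λ p → prime? p ×-dec (p ∣? n)) (applyUpTo (λ i → i) (suc n)))

Ω : (n : ℕ) → .{{NonZero n}} → ℕ
Ω n = length (factors (factorise n))

prodFin : (k : ℕ) → (Data.Fin.Fin k → ℕ) → ℕ
prodFin k f = product (Data.List.tabulate f)

{-# OPTIONS --safe #-}
-- If no nᵢ divides another, concatenating ordered factorizations of n_σ(1), …, n_σ(k) is injective in
-- the permutation σ and the k factorizations: in two equal concatenations the first blocks are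
-- prefixes of one another, so their products nᵢ, nⱼ are comparable under divisibility, forcing i = j
-- and then equal first blocks. This yields k! · ∏ m(nᵢ) distinct ordered factorizations of ∏ nᵢ.
-- The prime powers pᵢ^aᵢ of n form such an antichain of ω(n) numbers, m(p^a) ≥ 2^(a-1) because every
-- factorization of b gives two of p·b, and k! ≥ 2^(k-1); together these give both bounds on m(n).
module Submission where

open import Defs
open import Data.Nat as ℕ
  using (ℕ; zero; suc; 2+; _+_; _*_; _^_; _∸_; _!; _≤_; _<_; _≥_; z≤n; s≤s; _≟_; _≤?_; NonZero; >-nonZero; nonTrivial⇒≢1)
open import Data.Nat.Properties
open import Data.Nat.Divisibility using (_∣_; _∣?_; ∣-trans; ∣⇒≤; m∣m*n; ∣1⇒≡1; 1∣_)
open import Data.Nat.ListAction using (product; sum)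
open import Data.Nat.ListAction.Properties using (product-++; product≢0; ∈⇒∣product)
open import Data.Fin as Fin using (Fin; punchIn)
open import Data.Fin.Properties using (punchIn-injective; punchInᵢ≢i)
open import Data.Vec.Functional using (removeAt)
open import Algebra.Properties.CommutativeSemigroup *-commutativeSemigroup using (x∙yz≈y∙xz)
open import Algebra.Properties.CommutativeMonoid.Sum *-1-commutativeMonoid
  using () renaming (sum to ∏; sum-remove to ∏-removeAt)
open import Data.List using
  (List; []; _∷_; _++_; cartesianProductWith; map; concatMap; filter; length; applyUpTo; lookup; allFin; foldr)
open import Data.List.Properties using
  (∷-injective; ∷-injectiveˡ; ∷-injectiveʳ; ++-cancelˡ; ++-identityʳ; length-++; length-map; length-tabulate; map-tabulate; tabulate-lookup)
open import Data.List.Membership.Propositional using (_∈_; find; lose)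
open import Data.List.Membership.Propositional.Properties
open import Data.List.Relation.Binary.Subset.Propositional using (_⊆_)
open import Data.List.Relation.Unary.Any using (here; there)
open import Data.List.Relation.Unary.All as All using (All; []; _∷_)
import Data.List.Relation.Unary.All.Properties as All
open import Data.List.Relation.Unary.AllPairs using ([]; _∷_)
open import Data.List.Relation.Unary.Unique.Propositional using (Unique)
import Data.List.Relation.Unary.Unique.Propositional.Properties as Unique
open import Data.List.Relation.Binary.Permutation.Propositional.Properties using (↭-length; shift)
open import Data.Nat.Primality using (Prime; prime?; euclidsLemma; prime⇒irreducible; prime⇒nonTrivial)
open import Data.Nat.Primality.Factorisation using (factorise; factors; PrimeFactorisation; factorisationHasAllPrimeFactors)
open import Data.Product using (_×_; _,_; proj₁; proj₂; ∃)
open import Data.Sum using (_⊎_; inj₁; inj₂)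
open import Function using (_∘_; id)
open import Relation.Binary.PropositionalEquality
  using (_≡_; _≢_; refl; sym; trans; cong; cong₂; subst; subst₂; module ≡-Reasoning)
open import Relation.Nullary using (¬_; yes; no; contradiction)
open import Relation.Nullary.Decidable using (decidable-stable; _×-dec_)

module _ {A : Set} where

  Unique-⊆⇒length≤ : ∀ {xs ys : List A} → Unique xs → xs ⊆ ys → length xs ≤ length ys
  Unique-⊆⇒length≤ {[]}     _           _  = z≤n
  Unique-⊆⇒length≤ {x ∷ xs} (x∉xs ∷ xs!) xs⊆ys with ∈-∃++ (xs⊆ys (here refl))
  ... | us , vs , refl = begin
    suc (length xs)          ≤⟨ s≤s (Unique-⊆⇒length≤ xs! xs⊆us++vs) ⟩
    suc (length (us ++ vs))  ≡⟨ ↭-length (shift x us vs) ⟨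
    length (us ++ x ∷ vs)    ∎
    where
    open ≤-Reasoning
    xs⊆us++vs : xs ⊆ us ++ vs
    xs⊆us++vs {y} y∈xs with ∈-++⁻ us (xs⊆ys (there y∈xs))
    ... | inj₁ y∈us         = ∈-++⁺ˡ y∈us
    ... | inj₂ (here refl)  = contradiction y∈xs (Unique.Unique[x∷xs]⇒x∉xs (x∉xs ∷ xs!))
    ... | inj₂ (there y∈vs) = ∈-++⁺ʳ us y∈vs

  Unique-⊆⊇⇒length≡ : ∀ {xs ys : List A} → Unique xs → Unique ys → xs ⊆ ys → ys ⊆ xs → length xs ≡ length ys
  Unique-⊆⊇⇒length≡ xs! ys! xs⊆ys ys⊆xs = ≤-antisym (Unique-⊆⇒length≤ xs! xs⊆ys) (Unique-⊆⇒length≤ ys! ys⊆xs)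

  ++≡++⇒prefix : ∀ (xs ys us vs : List A) → xs ++ ys ≡ us ++ vs →
                 (∃ λ ws → us ≡ xs ++ ws) ⊎ (∃ λ ws → xs ≡ us ++ ws)
  ++≡++⇒prefix []       ys us       vs eq = inj₁ (us , refl)
  ++≡++⇒prefix (x ∷ xs) ys []       vs eq = inj₂ (x ∷ xs , refl)
  ++≡++⇒prefix (x ∷ xs) ys (u ∷ us) vs eq with ∷-injective eq
  ... | refl , eq′ with ++≡++⇒prefix xs ys us vs eq′
  ... | inj₁ (ws , refl) = inj₁ (ws , refl)
  ... | inj₂ (ws , refl) = inj₂ (ws , refl)

  length-concatMap-const : ∀ {B : Set} (f : A → List B) (xs : List A) {c} →
                           (∀ {x} → x ∈ xs → length (f x) ≡ c) → length (concatMap f xs) ≡ length xs * c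
  length-concatMap-const f []       _   = refl
  length-concatMap-const f (x ∷ xs) len = trans (length-++ (f x))
    (cong₂ _+_ (len (here refl)) (length-concatMap-const f xs (len ∘ there)))

  concatMap⁺ : ∀ {B : Set} {f : A → List B} {xs} →
               (∀ {x} → x ∈ xs → Unique (f x)) →
               (∀ {x y z} → x ∈ xs → y ∈ xs → z ∈ f x → z ∈ f y → x ≡ y) →
               Unique xs → Unique (concatMap f xs)
  concatMap⁺ {xs = []}     _  _        _            = []
  concatMap⁺ {f = f} {xs = x ∷ xs} fx! disjoint (x∉xs ∷ xs!) =
    Unique.++⁺ (fx! (here refl)) (concatMap⁺ (fx! ∘ there) (λ p q → disjoint (there p) (there q)) xs!) separate
    where
    separate : ∀ {z} → ¬ (z ∈ f x × z ∈ concatMap f xs)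
    separate (z∈fx , z∈rest) with find (∈-concatMap⁻ f z∈rest)
    ... | y , y∈xs , z∈fy = All.lookup x∉xs y∈xs (disjoint (here refl) (there y∈xs) z∈fx z∈fy)

  lookup-injective : ∀ {B : Set} (f : A → B) (xs : List A) → Unique (map f xs) →
                     ∀ {i j} → f (lookup xs i) ≡ f (lookup xs j) → i ≡ j
  lookup-injective f (x ∷ xs) _            {Fin.zero}  {Fin.zero}  _  = refl
  lookup-injective f (x ∷ xs) (fx∉ ∷ _)    {Fin.zero}  {Fin.suc j} eq =
    contradiction eq (All.lookup fx∉ (∈-map⁺ f (∈-lookup j)))
  lookup-injective f (x ∷ xs) (fx∉ ∷ _)    {Fin.suc i} {Fin.zero}  eq =
    contradiction (sym eq) (All.lookup fx∉ (∈-map⁺ f (∈-lookup i)))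
  lookup-injective f (x ∷ xs) (_ ∷ fxs!)   {Fin.suc i} {Fin.suc j} eq =
    cong Fin.suc (lookup-injective f xs fxs! eq)

module _ {A B C : Set} (f : A → B → C) where

  concatMap-map≡cartesianProductWith : ∀ xs ys → concatMap (λ x → map (f x) ys) xs ≡ cartesianProductWith f xs ys
  concatMap-map≡cartesianProductWith []       ys = refl
  concatMap-map≡cartesianProductWith (x ∷ xs) ys = cong (map (f x) ys ++_) (concatMap-map≡cartesianProductWith xs ys)

  length-cartesianProductWith : ∀ xs ys → length (cartesianProductWith f xs ys) ≡ length xs * length ys
  length-cartesianProductWith []       ys = refl
  length-cartesianProductWith (x ∷ xs) ys = trans (length-++ (map (f x) ys))
    (cong₂ _+_ (length-map (f x) ys) (length-cartesianProductWith xs ys))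

  cartesianProductWith⁺ : ∀ {xs ys} → (∀ {w x y z} → w ∈ xs → x ∈ xs → f w y ≡ f x z → w ≡ x × y ≡ z) →
                          Unique xs → Unique ys → Unique (cartesianProductWith f xs ys)
  cartesianProductWith⁺ {[]}     _     _            _   = []
  cartesianProductWith⁺ {x ∷ xs} {ys} f-inj (x∉xs ∷ xs!) ys! =
    Unique.++⁺ (Unique.map⁺ (proj₂ ∘ f-inj (here refl) (here refl)) ys!)
               (cartesianProductWith⁺ (λ p q → f-inj (there p) (there q)) xs! ys!) separate
    where
    separate : ∀ {v} → ¬ (v ∈ map (f x) ys × v ∈ cartesianProductWith f xs ys)
    separate (v∈fx , v∈rest) with ∈-map⁻ (f x) v∈fx | ∈-cartesianProductWith⁻ f xs ys v∈rest
    ... | _ , _ , refl | a , _ , a∈xs , _ , eq = All.lookup x∉xs a∈xs (proj₁ (f-inj (here refl) (there a∈xs) eq))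

≥2⇒nonZero : ∀ {n} → 2 ≤ n → NonZero n
≥2⇒nonZero 2≤n = >-nonZero (≤-trans (s≤s z≤n) 2≤n)

product≥1 : ∀ {l} → All (2 ≤_) l → 1 ≤ product l
product≥1 ≥2 = ℕ.>-nonZero⁻¹ _ {{product≢0 (All.map ≥2⇒nonZero ≥2)}}

length<product : ∀ {l} → All (2 ≤_) l → length l < product l
length<product []                     = s≤s z≤n
length<product {a ∷ l} (2≤a ∷ ≥2) = begin-strict
  suc (length l)        <⟨ s≤s (length<product ≥2) ⟩
  suc (product l)       ≤⟨ +-monoˡ-≤ (product l) (product≥1 ≥2) ⟩
  product l + product l ≡⟨ cong (product l +_) (+-identityʳ (product l)) ⟨
  2 * product l         ≤⟨ *-monoˡ-≤ (product l) 2≤a ⟩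
  a * product l         ∎
  where open ≤-Reasoning

product≡1⇒[] : ∀ {l} → All (2 ≤_) l → product l ≡ 1 → l ≡ []
product≡1⇒[] []                _  = refl
product≡1⇒[] {a ∷ l} (2≤a ∷ _) eq = contradiction (m*n≡1⇒m≡1 a (product l) eq) (>⇒≢ 2≤a)

product-map-mono : ∀ {A : Set} {f g : A → ℕ} xs → (∀ {x} → x ∈ xs → f x ≤ g x) →
                   product (map f xs) ≤ product (map g xs)
product-map-mono []       _   = ≤-refl
product-map-mono (x ∷ xs) f≤g = *-mono-≤ (f≤g (here refl)) (product-map-mono xs (f≤g ∘ there))

product-map-^ : ∀ {A : Set} b (f : A → ℕ) xs → product (map ((b ^_) ∘ f) xs) ≡ b ^ sum (map f xs)
product-map-^ b f []       = refl
product-map-^ b f (x ∷ xs) = trans (cong (b ^ f x *_) (product-map-^ b f xs)) (sym (^-distribˡ-+-* b (f x) _))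

++≡++⇒product∣ : ∀ xs ys us vs → xs ++ ys ≡ us ++ vs → product xs ∣ product us ⊎ product us ∣ product xs
++≡++⇒product∣ xs ys us vs eq with ++≡++⇒prefix xs ys us vs eq
... | inj₁ (ws , refl) = inj₁ (subst (product xs ∣_) (sym (product-++ xs ws)) (m∣m*n (product ws)))
... | inj₂ (ws , refl) = inj₂ (subst (product us ∣_) (sym (product-++ us ws)) (m∣m*n (product ws)))

product-++≡product⇒[] : ∀ xs ws → All (2 ≤_) (xs ++ ws) → product (xs ++ ws) ≡ product xs → ws ≡ []
product-++≡product⇒[] xs ws ≥2 eq = product≡1⇒[] (All.++⁻ʳ xs ≥2)
  (*-cancelˡ-≡ (product ws) 1 (product xs) (trans (sym (product-++ xs ws)) (trans eq (sym (*-identityʳ _)))))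
  where instance _ = product≢0 (All.map ≥2⇒nonZero (All.++⁻ˡ xs ≥2))

++≡++⇒≡ : ∀ xs ys us vs → All (2 ≤_) xs → All (2 ≤_) us → product xs ≡ product us →
          xs ++ ys ≡ us ++ vs → xs ≡ us
++≡++⇒≡ xs ys us vs xs≥2 us≥2 eqp eq with ++≡++⇒prefix xs ys us vs eq
... | inj₁ (ws , refl) = sym (trans (cong (xs ++_) (product-++≡product⇒[] xs ws us≥2 (sym eqp))) (++-identityʳ xs))
... | inj₂ (ws , refl) = trans (cong (us ++_) (product-++≡product⇒[] us ws xs≥2 eqp)) (++-identityʳ us)

-- Ordered factorizations

IsFactorization : ℕ → List ℕ → Set
IsFactorization n l = All (2 ≤_) l × product l ≡ n

module _ (xs : List ℕ) where

  listsOfLength-suc : ∀ r → listsOfLength (suc r) xs ≡ cartesianProductWith _∷_ xs (listsOfLength r xs)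
  listsOfLength-suc r = concatMap-map≡cartesianProductWith _∷_ xs (listsOfLength r xs)

  ∈-listsOfLength⁻ : ∀ r {l} → l ∈ listsOfLength r xs → length l ≡ r × All (_∈ xs) l
  ∈-listsOfLength⁻ zero    (here refl) = refl , []
  ∈-listsOfLength⁻ (suc r) l∈
    with ∈-cartesianProductWith⁻ _∷_ xs (listsOfLength r xs) (subst (_ ∈_) (listsOfLength-suc r) l∈)
  ... | d , l′ , d∈xs , l′∈ , refl = let len , ∈xs = ∈-listsOfLength⁻ r l′∈ in cong suc len , d∈xs ∷ ∈xs

  ∈-listsOfLength⁺ : ∀ {l} → All (_∈ xs) l → l ∈ listsOfLength (length l) xs
  ∈-listsOfLength⁺ []                   = here refl
  ∈-listsOfLength⁺ {d ∷ l} (d∈xs ∷ ∈xs) =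
    subst (_ ∈_) (sym (listsOfLength-suc (length l))) (∈-cartesianProductWith⁺ _∷_ d∈xs (∈-listsOfLength⁺ ∈xs))

  listsOfLength-Unique : ∀ r → Unique xs → Unique (listsOfLength r xs)
  listsOfLength-Unique zero    _   = [] ∷ []
  listsOfLength-Unique (suc r) xs! = subst Unique (sym (listsOfLength-suc r))
    (cartesianProductWith⁺ _∷_ (λ _ _ → ∷-injective) xs! (listsOfLength-Unique r xs!))

module _ {n : ℕ} where

  ∈-from2to⁻ : ∀ {d} → d ∈ from2to n → 2 ≤ d
  ∈-from2to⁻ = proj₂ ∘ ∈-filter⁻ (2 ≤?_) {xs = applyUpTo id (suc n)}

  ∈-from2to⁺ : ∀ {d} → 2 ≤ d → d ≤ n → d ∈ from2to n
  ∈-from2to⁺ 2≤d d≤n = ∈-filter⁺ (2 ≤?_) (∈-applyUpTo⁺ id (s≤s d≤n)) 2≤d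

  from2to-Unique : Unique (from2to n)
  from2to-Unique = Unique.filter⁺ (2 ≤?_) (Unique.upTo⁺ (suc n))

  private
    lists : ℕ → List (List ℕ)
    lists r = listsOfLength (suc r) (from2to n)

  ∈-orderedFactorizations⁻ : ∀ {l} → l ∈ orderedFactorizations n → IsFactorization n l
  ∈-orderedFactorizations⁻ l∈ with ∈-filter⁻ (λ l → product l ≟ n) l∈
  ... | l∈cands , eq with find (∈-concatMap⁻ lists {xs = applyUpTo id n} l∈cands)
  ... | r , _ , l∈lists = All.map ∈-from2to⁻ (proj₂ (∈-listsOfLength⁻ (from2to n) (suc r) l∈lists)) , eq

  ∈-orderedFactorizations⁺ : ∀ {l} → 2 ≤ n → IsFactorization n l → l ∈ orderedFactorizations n
  ∈-orderedFactorizations⁺ {[]}    (s≤s ()) (_ , refl)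
  ∈-orderedFactorizations⁺ {d ∷ l} 2≤n (≥2 , refl) = ∈-filter⁺ (λ l → product l ≟ n) l∈cands refl
    where
    instance _ = ≥2⇒nonZero 2≤n
    entries : All (_∈ from2to n) (d ∷ l)
    entries = All.tabulate λ e∈ → ∈-from2to⁺ (All.lookup ≥2 e∈) (∣⇒≤ (∈⇒∣product e∈))
    length<n : length l < n
    length<n = <-trans (n<1+n (length l)) (length<product ≥2)
    l∈cands : d ∷ l ∈ candidates n
    l∈cands = ∈-concatMap⁺ lists (lose (∈-applyUpTo⁺ id length<n) (∈-listsOfLength⁺ (from2to n) entries))

  orderedFactorizations-Unique : Unique (orderedFactorizations n)
  orderedFactorizations-Unique = Unique.filter⁺ (λ l → product l ≟ n) (concatMap⁺ lists! sameLength (Unique.upTo⁺ n))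
    where
    lists! : ∀ {r} → r ∈ applyUpTo id n → Unique (lists r)
    lists! {r} _ = listsOfLength-Unique (from2to n) (suc r) from2to-Unique
    length≡ : ∀ {r l} → l ∈ lists r → length l ≡ suc r
    length≡ {r} = proj₁ ∘ ∈-listsOfLength⁻ (from2to n) (suc r)
    sameLength : ∀ {r s l} → r ∈ applyUpTo id n → s ∈ applyUpTo id n → l ∈ lists r → l ∈ lists s → r ≡ s
    sameLength _ _ l∈r l∈s = suc-injective (trans (sym (length≡ l∈r)) (length≡ l∈s))

  m≡length : 2 ≤ n → m n ≡ length (orderedFactorizations n)
  m≡length (s≤s (s≤s _)) = refl

  Unique⇒length≤m : ∀ {L} → 2 ≤ n → Unique L → (∀ {l} → l ∈ L → IsFactorization n l) → length L ≤ m n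
  Unique⇒length≤m {L} 2≤n L! L⊆ = begin
    length L                              ≤⟨ Unique-⊆⇒length≤ L! (∈-orderedFactorizations⁺ 2≤n ∘ L⊆) ⟩
    length (orderedFactorizations n)      ≡⟨ m≡length 2≤n ⟨
    m n                                   ∎
    where open ≤-Reasoning

-- Concatenating factorizations of an antichain

prodFin≡∏ : ∀ k (n : Fin k → ℕ) → prodFin k n ≡ ∏ n
prodFin≡∏ zero    n = refl
prodFin≡∏ (suc k) n = cong (n Fin.zero *_) (prodFin≡∏ k (n ∘ Fin.suc))

prodFin-removeAt : ∀ k (n : Fin (suc k) → ℕ) i → prodFin (suc k) n ≡ n i * prodFin k (removeAt n i)
prodFin-removeAt k n i = begin
  prodFin (suc k) n            ≡⟨ prodFin≡∏ (suc k) n ⟩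
  ∏ n                          ≡⟨ ∏-removeAt n ⟩
  n i * ∏ (removeAt n i)       ≡⟨ cong (n i *_) (prodFin≡∏ k (removeAt n i)) ⟨
  n i * prodFin k (removeAt n i) ∎
  where open ≡-Reasoning

prodFin-lookup : ∀ {A : Set} (f : A → ℕ) xs → prodFin (length xs) (f ∘ lookup xs) ≡ product (map f xs)
prodFin-lookup f xs = cong product (trans (sym (map-tabulate (lookup xs) f)) (cong (map f) (tabulate-lookup xs)))

∣-Antichain : ∀ {k} → (Fin k → ℕ) → Set
∣-Antichain n = ∀ i j → n i ∣ n j → i ≡ j

∣-Antichain-removeAt : ∀ {k} {n : Fin (suc k) → ℕ} → ∣-Antichain n → ∀ i → ∣-Antichain (removeAt n i)
∣-Antichain-removeAt antichain i a b d = punchIn-injective i a b (antichain (punchIn i a) (punchIn i b) d)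

-- The concatenations x₁ ++ ⋯ ++ x_k where, for some ordering σ of the indices, xⱼ is an ordered
-- factorization of n (σ j); startingWith k n i collects those with σ 1 = i.
concatenatedFactorizations : (k : ℕ) → (Fin k → ℕ) → List (List ℕ)
startingWith : ∀ k → (Fin (suc k) → ℕ) → Fin (suc k) → List (List ℕ)

concatenatedFactorizations zero    n = [] ∷ []
concatenatedFactorizations (suc k) n = concatMap (startingWith k n) (allFin (suc k))

startingWith k n i =
  cartesianProductWith _++_ (orderedFactorizations (n i)) (concatenatedFactorizations k (removeAt n i))

∈-concatenatedFactorizations⇒IsFactorization : ∀ k n {l} → l ∈ concatenatedFactorizations k n →
                                               IsFactorization (prodFin k n) l
∈-concatenatedFactorizations⇒IsFactorization zero    n (here refl) = [] , refl
∈-concatenatedFactorizations⇒IsFactorization (suc k) n l∈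
  with find (∈-concatMap⁻ (startingWith k n) {xs = allFin (suc k)} l∈)
... | i , _ , l∈i with ∈-cartesianProductWith⁻ _++_ _ _ l∈i
... | x , y , x∈ , y∈ , refl
  with ∈-orderedFactorizations⁻ {n i} x∈ | ∈-concatenatedFactorizations⇒IsFactorization k (removeAt n i) y∈
... | x≥2 , x≡ | y≥2 , y≡ = All.++⁺ x≥2 y≥2 , (begin
  product (x ++ y)                ≡⟨ product-++ x y ⟩
  product x * product y           ≡⟨ cong₂ _*_ x≡ y≡ ⟩
  n i * prodFin k (removeAt n i)  ≡⟨ prodFin-removeAt k n i ⟨
  prodFin (suc k) n               ∎)
  where open ≡-Reasoning

length-concatenatedFactorizations : ∀ k n → (∀ i → 2 ≤ n i) →
                                    length (concatenatedFactorizations k n) ≡ k ! * prodFin k (m ∘ n)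
length-concatenatedFactorizations zero    n _  = refl
length-concatenatedFactorizations (suc k) n ≥2 = begin
  length (concatMap (startingWith k n) (allFin (suc k)))
    ≡⟨ length-concatMap-const (startingWith k n) (allFin (suc k)) (λ {i} _ → length-startingWith i) ⟩
  length (allFin (suc k)) * (k ! * ∏m)  ≡⟨ cong (_* (k ! * ∏m)) (length-tabulate {n = suc k} id) ⟩
  suc k * (k ! * ∏m)                    ≡⟨ *-assoc (suc k) (k !) ∏m ⟨
  suc k ! * ∏m                          ∎
  where
  open ≡-Reasoning
  ∏m = prodFin (suc k) (m ∘ n)
  length-startingWith : ∀ i → length (startingWith k n i) ≡ k ! * ∏m
  length-startingWith i = begin
    length (startingWith k n i)
      ≡⟨ length-cartesianProductWith _++_ (orderedFactorizations (n i)) _ ⟩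
    length (orderedFactorizations (n i)) * length (concatenatedFactorizations k (removeAt n i))
      ≡⟨ cong₂ _*_ (sym (m≡length {n i} (≥2 i))) (length-concatenatedFactorizations k (removeAt n i) (≥2 ∘ punchIn i)) ⟩
    m (n i) * (k ! * prodFin k (m ∘ removeAt n i))    ≡⟨ x∙yz≈y∙xz (m (n i)) (k !) _ ⟩
    k ! * (m (n i) * prodFin k (removeAt (m ∘ n) i))  ≡⟨ cong (k ! *_) (prodFin-removeAt k (m ∘ n) i) ⟨
    k ! * ∏m                                          ∎

concatenatedFactorizations-Unique : ∀ k n → ∣-Antichain n → Unique (concatenatedFactorizations k n)
concatenatedFactorizations-Unique zero    n _         = [] ∷ []
concatenatedFactorizations-Unique (suc k) n antichain =
  concatMap⁺ (λ {i} _ → cartesianProductWith⁺ _++_ (prefix-injective i) (orderedFactorizations-Unique {n i})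
                          (concatenatedFactorizations-Unique k (removeAt n i) (∣-Antichain-removeAt antichain i)))
             sameFirstBlock (Unique.allFin⁺ (suc k))
  where
  prefix-injective : ∀ i {w x y z} → w ∈ orderedFactorizations (n i) → x ∈ orderedFactorizations (n i) →
                     w ++ y ≡ x ++ z → w ≡ x × y ≡ z
  prefix-injective i {w} {x} {y} {z} w∈ x∈ eq
    with ∈-orderedFactorizations⁻ {n i} w∈ | ∈-orderedFactorizations⁻ {n i} x∈
  ... | w≥2 , w≡ | x≥2 , x≡ with ++≡++⇒≡ w y x z w≥2 x≥2 (trans w≡ (sym x≡)) eq
  ... | refl = refl , ++-cancelˡ w y z eq

  -- Comparable first blocks have comparable products n i, n j.
  sameFirstBlock : ∀ {i j l} → i ∈ allFin (suc k) → j ∈ allFin (suc k) →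
                   l ∈ startingWith k n i → l ∈ startingWith k n j → i ≡ j
  sameFirstBlock {i} {j} _ _ l∈i l∈j
    with ∈-cartesianProductWith⁻ _++_ _ _ l∈i | ∈-cartesianProductWith⁻ _++_ _ _ l∈j
  ... | x , y , x∈ , _ , refl | u , v , u∈ , _ , eq
    with proj₂ (∈-orderedFactorizations⁻ {n i} x∈) | proj₂ (∈-orderedFactorizations⁻ {n j} u∈)
       | ++≡++⇒product∣ x y u v eq
  ... | x≡ | u≡ | inj₁ x∣u = antichain i j (subst₂ _∣_ x≡ u≡ x∣u)
  ... | x≡ | u≡ | inj₂ u∣x = sym (antichain j i (subst₂ _∣_ u≡ x≡ u∣x))

prodFin≥2 : ∀ k (n : Fin (suc k) → ℕ) → (∀ i → 2 ≤ n i) → 2 ≤ prodFin (suc k) n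
prodFin≥2 k n ≥2 = ≤-trans (≥2 Fin.zero) (m≤m*n (n Fin.zero) (prodFin k (n ∘ Fin.suc)))
  where instance _ = product≢0 (All.tabulate⁺ (≥2⇒nonZero ∘ ≥2 ∘ Fin.suc))

m-prodFin≥k!*prodFin-m : ∀ k n → (∀ i → 2 ≤ n i) → ∣-Antichain n →
                         k ! * prodFin k (m ∘ n) ≤ m (prodFin k n)
m-prodFin≥k!*prodFin-m zero    n _  _         = ≤-refl
m-prodFin≥k!*prodFin-m (suc k) n ≥2 antichain = begin
  suc k ! * prodFin (suc k) (m ∘ n)                ≡⟨ length-concatenatedFactorizations (suc k) n ≥2 ⟨
  length (concatenatedFactorizations (suc k) n)    ≤⟨ Unique⇒length≤m (prodFin≥2 k n ≥2)
                                                        (concatenatedFactorizations-Unique (suc k) n antichain)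
                                                        (∈-concatenatedFactorizations⇒IsFactorization (suc k) n) ⟩
  m (prodFin (suc k) n)                            ∎
  where open ≤-Reasoning

nonZero∧≢1⇒≥2 : ∀ {x} → NonZero x → x ≢ 1 → 2 ≤ x
nonZero∧≢1⇒≥2 {1}    _ x≢1 = contradiction refl x≢1
nonZero∧≢1⇒≥2 {2+ _} _ _   = s≤s (s≤s z≤n)

-- 1 divides everything, so it cannot belong to an antichain with two or more members.
∣-Antichain⇒≥2 : ∀ {k} {n : Fin (2 + k) → ℕ} → (∀ i → NonZero (n i)) → ∣-Antichain n → ∀ i → 2 ≤ n i
∣-Antichain⇒≥2 {n = n} nz antichain i = nonZero∧≢1⇒≥2 (nz i) n≢1
  where
  j = punchIn i Fin.zero
  n≢1 : n i ≢ 1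
  n≢1 eq = punchInᵢ≢i i Fin.zero (sym (antichain i j (subst (_∣ n j) (sym eq) (1∣ n j))))

incomparable⇒∣-Antichain : ∀ {k} {n : Fin k → ℕ} → (∀ i j → i ≢ j → ¬ (n i ∣ n j)) → ∣-Antichain n
incomparable⇒∣-Antichain incomparable i j n∣ = decidable-stable (i Fin.≟ j) (λ i≢j → incomparable i j i≢j n∣)

incomparable⇒m-prodFin≥k!*prodFin-m : (k : ℕ) (n : Fin k → ℕ) → (∀ i → NonZero (n i)) →
  (∀ i j → i ≢ j → ¬ (n i ∣ n j)) → m (prodFin k n) ≥ (k !) * prodFin k (λ i → m (n i))
incomparable⇒m-prodFin≥k!*prodFin-m 0      n _  _            = ≤-refl
incomparable⇒m-prodFin≥k!*prodFin-m 1      n _  _            = ≤-reflexive (begin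
  1 ! * (m (n Fin.zero) * 1)  ≡⟨ *-identityˡ _ ⟩
  m (n Fin.zero) * 1          ≡⟨ *-identityʳ _ ⟩
  m (n Fin.zero)              ≡⟨ cong m (*-identityʳ (n Fin.zero)) ⟨
  m (n Fin.zero * 1)          ∎)
  where open ≡-Reasoning
incomparable⇒m-prodFin≥k!*prodFin-m (2+ k) n nz incomparable =
  m-prodFin≥k!*prodFin-m (2 + k) n (∣-Antichain⇒≥2 nz antichain) antichain
  where antichain = incomparable⇒∣-Antichain incomparable

-- Prime powers

multiplyHead : ℕ → List ℕ → List ℕ
multiplyHead a []       = []
multiplyHead a (x ∷ xs) = a * x ∷ xs

multiplyHead-injective : ∀ a .{{_ : NonZero a}} {xs ys} → multiplyHead a xs ≡ multiplyHead a ys → xs ≡ ys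
multiplyHead-injective a {[]}     {[]}     _  = refl
multiplyHead-injective a {x ∷ xs} {y ∷ ys} eq with ∷-injective eq
... | ax≡ay , refl = cong (_∷ xs) (*-cancelˡ-≡ x y a ax≡ay)

-- A factorization of b gives two of a * b: prepend a, or multiply its first factor by a.
2*m≤m[*] : ∀ {a b} → 2 ≤ a → 2 ≤ b → 2 * m b ≤ m (a * b)
2*m≤m[*] {a} {b} 2≤a 2≤b = begin
  2 * m b                                                  ≡⟨ cong (m b +_) (+-identityʳ (m b)) ⟩
  m b + m b                                                ≡⟨ cong₂ _+_ (m≡length-map (a ∷_))
                                                                        (m≡length-map (multiplyHead a)) ⟩
  length (map (a ∷_) F) + length (map (multiplyHead a) F)  ≡⟨ length-++ (map (a ∷_) F) ⟨
  length (map (a ∷_) F ++ map (multiplyHead a) F)          ≤⟨ Unique⇒length≤m 2≤ab unique sound ⟩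
  m (a * b)                                                ∎
  where
  open ≤-Reasoning
  instance _ = ≥2⇒nonZero 2≤a
  F = orderedFactorizations b
  m≡length-map : (f : List ℕ → List ℕ) → m b ≡ length (map f F)
  m≡length-map f = trans (m≡length 2≤b) (sym (length-map f F))
  2≤ab : 2 ≤ a * b
  2≤ab = ≤-trans 2≤a (m≤m*n a b {{≥2⇒nonZero 2≤b}})
  separate : ∀ {l} → ¬ (l ∈ map (a ∷_) F × l ∈ map (multiplyHead a) F)
  separate (l∈₁ , l∈₂) with ∈-map⁻ (a ∷_) l∈₁ | ∈-map⁻ (multiplyHead a) l∈₂
  ... | _ , _ , refl | x ∷ _ , x∈ , eq with ∈-orderedFactorizations⁻ {b} x∈
  ... | 2≤x ∷ _ , _ = <⇒≢ 2≤x (sym (*-cancelˡ-≡ x 1 a (trans (sym (∷-injectiveˡ eq)) (sym (*-identityʳ a)))))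
  unique : Unique (map (a ∷_) F ++ map (multiplyHead a) F)
  unique = Unique.++⁺ (Unique.map⁺ ∷-injectiveʳ (orderedFactorizations-Unique {b}))
                      (Unique.map⁺ (multiplyHead-injective a) (orderedFactorizations-Unique {b})) separate
  sound : ∀ {l} → l ∈ map (a ∷_) F ++ map (multiplyHead a) F → IsFactorization (a * b) l
  sound l∈ with ∈-++⁻ (map (a ∷_) F) l∈
  ... | inj₁ l∈₁ with ∈-map⁻ (a ∷_) l∈₁
  ...   | y , y∈ , refl with ∈-orderedFactorizations⁻ {b} y∈
  ...     | y≥2 , refl = 2≤a ∷ y≥2 , refl
  sound l∈ | inj₂ l∈₂ with ∈-map⁻ (multiplyHead a) l∈₂
  ...   | x , x∈ , refl with x | ∈-orderedFactorizations⁻ {b} x∈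
  ...     | []      | _ , refl = contradiction 2≤b (<-irrefl refl)
  ...     | x₀ ∷ xs | 2≤x₀ ∷ xs≥2 , refl = ≤-trans 2≤x₀ (m≤n*m x₀ a) ∷ xs≥2 , *-assoc a x₀ (product xs)

2≤p⇒2≤p^1+d : ∀ {p} → 2 ≤ p → ∀ d → 2 ≤ p ^ suc d
2≤p⇒2≤p^1+d {p} 2≤p d = ≤-trans 2≤p (m≤m*n p (p ^ d) {{m^n≢0 p d {{≥2⇒nonZero 2≤p}}}})

1≤m : ∀ {n} → 2 ≤ n → 1 ≤ m n
1≤m {n} 2≤n = Unique⇒length≤m 2≤n ([] ∷ []) λ { (here refl) → 2≤n ∷ [] , *-identityʳ n }

2^e≤m[p^1+e] : ∀ {p} → 2 ≤ p → ∀ e → 2 ^ e ≤ m (p ^ suc e)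
2^e≤m[p^1+e] {p} 2≤p zero    = 1≤m (subst (2 ≤_) (sym (*-identityʳ p)) 2≤p)
2^e≤m[p^1+e] {p} 2≤p (suc e) = begin
  2 * 2 ^ e              ≤⟨ *-monoʳ-≤ 2 (2^e≤m[p^1+e] 2≤p e) ⟩
  2 * m (p ^ suc e)      ≤⟨ 2*m≤m[*] 2≤p (2≤p⇒2≤p^1+d 2≤p e) ⟩
  m (p ^ suc (suc e))    ∎
  where open ≤-Reasoning

-- Collecting prime factors

-- Exponents are stored minus one, so every pair (p , d) denotes a genuine power p ^ (1 + d) of p.
power : ℕ × ℕ → ℕ
power (p , d) = p ^ suc d

bases : List (ℕ × ℕ) → List ℕ
bases = map proj₁

exponentSum : List (ℕ × ℕ) → ℕ
exponentSum ps = sum (map (suc ∘ proj₂) ps)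

insert : ℕ → List (ℕ × ℕ) → List (ℕ × ℕ)
insert q []             = (q , 0) ∷ []
insert q ((p , d) ∷ ps) with q ≟ p
... | yes _ = (p , suc d) ∷ ps
... | no  _ = (p , d) ∷ insert q ps

collect : List ℕ → List (ℕ × ℕ)
collect = foldr insert []

module _ (q : ℕ) where

  product-insert : ∀ ps → product (map power (insert q ps)) ≡ q * product (map power ps)
  product-insert []             = *-identityʳ (q * 1)
  product-insert ((p , d) ∷ ps) with q ≟ p
  ... | yes refl = *-assoc q (q ^ suc d) _
  ... | no  _    = trans (cong (p ^ suc d *_) (product-insert ps)) (x∙yz≈y∙xz (p ^ suc d) q _)

  exponentSum-insert : ∀ ps → exponentSum (insert q ps) ≡ suc (exponentSum ps)
  exponentSum-insert []             = refl
  exponentSum-insert ((p , d) ∷ ps) with q ≟ p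
  ... | yes _ = refl
  ... | no  _ = trans (cong (suc d +_) (exponentSum-insert ps)) (+-suc (suc d) _)

  ∈-bases-insert⁻ : ∀ ps {x} → x ∈ bases (insert q ps) → x ≡ q ⊎ x ∈ bases ps
  ∈-bases-insert⁻ []             (here x≡q) = inj₁ x≡q
  ∈-bases-insert⁻ ((p , d) ∷ ps) x∈ with q ≟ p | x∈
  ... | yes _ | x∈′         = inj₂ x∈′
  ... | no  _ | here x≡p    = inj₂ (here x≡p)
  ... | no  _ | there x∈′ with ∈-bases-insert⁻ ps x∈′
  ...   | inj₁ x≡q  = inj₁ x≡q
  ...   | inj₂ x∈ps = inj₂ (there x∈ps)

  ∈-bases-insert⁺ : ∀ ps {x} → x ≡ q ⊎ x ∈ bases ps → x ∈ bases (insert q ps)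
  ∈-bases-insert⁺ []             (inj₁ refl) = here refl
  ∈-bases-insert⁺ ((p , d) ∷ ps) x≡q⊎x∈ with q ≟ p | x≡q⊎x∈
  ... | yes q≡p | inj₁ refl         = here q≡p
  ... | yes _   | inj₂ x∈           = x∈
  ... | no  _   | inj₂ (here x≡p)   = here x≡p
  ... | no  _   | inj₁ x≡q          = there (∈-bases-insert⁺ ps (inj₁ x≡q))
  ... | no  _   | inj₂ (there x∈ps) = there (∈-bases-insert⁺ ps (inj₂ x∈ps))

  bases-insert-Unique : ∀ ps → Unique (bases ps) → Unique (bases (insert q ps))
  bases-insert-Unique []             _ = [] ∷ []
  bases-insert-Unique ((p , d) ∷ ps) ps! with q ≟ p | ps!
  ... | yes _   | _            = ps!
  ... | no  q≢p | p∉ps ∷ ps!′ = All.tabulate p∉ ∷ bases-insert-Unique ps ps!′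
    where
    p∉ : ∀ {x} → x ∈ bases (insert q ps) → p ≢ x
    p∉ x∈ p≡x with ∈-bases-insert⁻ ps x∈
    ... | inj₁ x≡q  = q≢p (sym (trans p≡x x≡q))
    ... | inj₂ x∈ps = All.lookup p∉ps x∈ps p≡x

product-collect : ∀ fs → product (map power (collect fs)) ≡ product fs
product-collect []       = refl
product-collect (q ∷ fs) = trans (product-insert q (collect fs)) (cong (q *_) (product-collect fs))

exponentSum-collect : ∀ fs → exponentSum (collect fs) ≡ length fs
exponentSum-collect []       = refl
exponentSum-collect (q ∷ fs) = trans (exponentSum-insert q (collect fs)) (cong suc (exponentSum-collect fs))

exponentSum≡ : ∀ ps → exponentSum ps ≡ sum (map proj₂ ps) + length ps
exponentSum≡ []             = refl
exponentSum≡ ((p , d) ∷ ps) = begin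
  suc d + exponentSum ps                 ≡⟨ cong (suc d +_) (exponentSum≡ ps) ⟩
  suc d + (D + length ps)                ≡⟨ cong suc (+-assoc d D (length ps)) ⟨
  suc (d + D + length ps)                ≡⟨ +-suc (d + D) (length ps) ⟨
  d + D + suc (length ps)                ∎
  where
  open ≡-Reasoning
  D = sum (map proj₂ ps)

bases-collect-Unique : ∀ fs → Unique (bases (collect fs))
bases-collect-Unique []       = []
bases-collect-Unique (q ∷ fs) = bases-insert-Unique q (collect fs) (bases-collect-Unique fs)

bases-collect⊆ : ∀ fs → bases (collect fs) ⊆ fs
bases-collect⊆ (q ∷ fs) x∈ with ∈-bases-insert⁻ q (collect fs) x∈
... | inj₁ refl = here refl
... | inj₂ x∈′  = there (bases-collect⊆ fs x∈′)

⊆bases-collect : ∀ fs → fs ⊆ bases (collect fs)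
⊆bases-collect (q ∷ fs) (here refl) = ∈-bases-insert⁺ q (collect fs) (inj₁ refl)
⊆bases-collect (q ∷ fs) (there x∈)  = ∈-bases-insert⁺ q (collect fs) (inj₂ (⊆bases-collect fs x∈))

prime∣prime^⇒≡ : ∀ {p q} e → Prime p → Prime q → p ∣ q ^ e → p ≡ q
prime∣prime^⇒≡ zero    pp _  p∣1 = contradiction (∣1⇒≡1 p∣1) (nonTrivial⇒≢1 {{prime⇒nonTrivial pp}})
prime∣prime^⇒≡ {q = q} (suc e) pp pq p∣qqᵉ with euclidsLemma q (q ^ e) pp p∣qqᵉ
... | inj₂ p∣qᵉ = prime∣prime^⇒≡ e pp pq p∣qᵉ
... | inj₁ p∣q with prime⇒irreducible pq p∣q
...   | inj₁ p≡1 = contradiction p≡1 (nonTrivial⇒≢1 {{prime⇒nonTrivial pp}})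
...   | inj₂ p≡q = p≡q

power-∣-Antichain : ∀ ps → All Prime (bases ps) → Unique (bases ps) → ∣-Antichain (power ∘ lookup ps)
power-∣-Antichain ps prime bases! i j pᵢ∣ = lookup-injective proj₁ ps bases!
  (prime∣prime^⇒≡ (suc (proj₂ (lookup ps j))) (prime-at i) (prime-at j) (∣-trans (m∣m*n _) pᵢ∣))
  where
  prime-at : ∀ i → Prime (proj₁ (lookup ps i))
  prime-at i = All.lookup prime (∈-map⁺ proj₁ (∈-lookup i))

2^k≤[1+k]! : ∀ k → 2 ^ k ≤ suc k !
2^k≤[1+k]! zero    = ≤-refl
2^k≤[1+k]! (suc k) = *-mono-≤ {2} {2 + k} (s≤s (s≤s z≤n)) (2^k≤[1+k]! k)

2^[d+k∸1]≤k!*2^d : ∀ d k → 2 ^ (d + k ∸ 1) ≤ k ! * 2 ^ d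
2^[d+k∸1]≤k!*2^d d zero    = begin
  2 ^ (d + 0 ∸ 1)  ≤⟨ ^-monoʳ-≤ 2 (m∸n≤m (d + 0) 1) ⟩
  2 ^ (d + 0)      ≡⟨ cong (2 ^_) (+-identityʳ d) ⟩
  2 ^ d            ≡⟨ *-identityˡ (2 ^ d) ⟨
  1 * 2 ^ d        ∎
  where open ≤-Reasoning
2^[d+k∸1]≤k!*2^d d (suc k) = begin
  2 ^ (d + suc k ∸ 1)  ≡⟨ cong (λ e → 2 ^ (e ∸ 1)) (+-suc d k) ⟩
  2 ^ (d + k)          ≡⟨ ^-distribˡ-+-* 2 d k ⟩
  2 ^ d * 2 ^ k        ≤⟨ *-monoʳ-≤ (2 ^ d) (2^k≤[1+k]! k) ⟩
  2 ^ d * suc k !      ≡⟨ *-comm (2 ^ d) (suc k !) ⟩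
  suc k ! * 2 ^ d      ∎
  where open ≤-Reasoning

m-product-power≥ : ∀ ps → All Prime (bases ps) → Unique (bases ps) →
                   length ps ! * 2 ^ sum (map proj₂ ps) ≤ m (product (map power ps))
m-product-power≥ ps prime bases! = begin
  k ! * 2 ^ sum (map proj₂ ps)             ≡⟨ cong (k ! *_) (product-map-^ 2 proj₂ ps) ⟨
  k ! * product (map ((2 ^_) ∘ proj₂) ps)  ≤⟨ *-monoʳ-≤ (k !) (product-map-mono ps 2^d≤m) ⟩
  k ! * product (map (m ∘ power) ps)       ≡⟨ cong (k ! *_) (prodFin-lookup (m ∘ power) ps) ⟨
  k ! * prodFin k (m ∘ power ∘ lookup ps)
    ≤⟨ m-prodFin≥k!*prodFin-m k (power ∘ lookup ps) powers≥2 (power-∣-Antichain ps prime bases!) ⟩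
  m (prodFin k (power ∘ lookup ps))        ≡⟨ cong m (prodFin-lookup power ps) ⟩
  m (product (map power ps))               ∎
  where
  open ≤-Reasoning
  k = length ps
  base≥2 : ∀ {s} → s ∈ ps → 2 ≤ proj₁ s
  base≥2 s∈ = ℕ.nonTrivial⇒n>1 _ {{prime⇒nonTrivial (All.lookup prime (∈-map⁺ proj₁ s∈))}}
  2^d≤m : ∀ {s} → s ∈ ps → 2 ^ proj₂ s ≤ m (power s)
  2^d≤m {s} s∈ = 2^e≤m[p^1+e] (base≥2 s∈) (proj₂ s)
  powers≥2 : ∀ i → 2 ≤ power (lookup ps i)
  powers≥2 i = 2≤p⇒2≤p^1+d (base≥2 (∈-lookup i)) (proj₂ (lookup ps i))

module _ (n : ℕ) .{{_ : NonZero n}} where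

  private
    primes = factors (factorise n)
    ps = collect primes
    k = length ps
    D = sum (map proj₂ ps)

    n≡∏primes : n ≡ product primes
    n≡∏primes = PrimeFactorisation.isFactorisation (factorise n)

    primes-prime : All Prime primes
    primes-prime = PrimeFactorisation.factorsPrime (factorise n)

    P? = λ p → prime? p ×-dec (p ∣? n)
    primeDivisors = filter P? (applyUpTo id (suc n))

    primeDivisors⊆bases : primeDivisors ⊆ bases ps
    primeDivisors⊆bases p∈ with ∈-filter⁻ P? {xs = applyUpTo id (suc n)} p∈
    ... | _ , pp , p∣n =
      ⊆bases-collect primes (factorisationHasAllPrimeFactors pp (subst (_ ∣_) n≡∏primes p∣n) primes-prime)

    bases⊆primeDivisors : bases ps ⊆ primeDivisors
    bases⊆primeDivisors p∈ = ∈-filter⁺ P? (∈-applyUpTo⁺ id (s≤s (∣⇒≤ p∣n))) (All.lookup primes-prime p∈primes , p∣n)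
      where
      p∈primes = bases-collect⊆ primes p∈
      p∣n = subst (_ ∣_) (sym n≡∏primes) (∈⇒∣product p∈primes)

  ω≡k : ω n ≡ k
  ω≡k = trans (Unique-⊆⊇⇒length≡ (Unique.filter⁺ P? (Unique.upTo⁺ (suc n))) (bases-collect-Unique primes)
                                  primeDivisors⊆bases bases⊆primeDivisors)
              (length-map proj₁ ps)

  Ω≡D+k : Ω n ≡ D + k
  Ω≡D+k = trans (sym (exponentSum-collect primes)) (exponentSum≡ ps)

  k!*2^D≤m : k ! * 2 ^ D ≤ m n
  k!*2^D≤m = subst (λ x → k ! * 2 ^ D ≤ m x) (trans (product-collect primes) (sym n≡∏primes))
    (m-product-power≥ ps (All.tabulate (All.lookup primes-prime ∘ bases-collect⊆ primes)) (bases-collect-Unique primes))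

  m≥ω!*2^[Ω∸ω] : m n ≥ (ω n !) * 2 ^ (Ω n ∸ ω n)
  m≥ω!*2^[Ω∸ω] = begin
    ω n ! * 2 ^ (Ω n ∸ ω n)  ≡⟨ cong₂ (λ a b → a ! * 2 ^ (b ∸ a)) ω≡k Ω≡D+k ⟩
    k ! * 2 ^ (D + k ∸ k)    ≡⟨ cong (λ e → k ! * 2 ^ e) (m+n∸n≡m D k) ⟩
    k ! * 2 ^ D              ≤⟨ k!*2^D≤m ⟩
    m n                      ∎
    where open ≤-Reasoning

  m≥2^[Ω∸1] : m n ≥ 2 ^ (Ω n ∸ 1)
  m≥2^[Ω∸1] = begin
    2 ^ (Ω n ∸ 1)            ≡⟨ cong (λ e → 2 ^ (e ∸ 1)) Ω≡D+k ⟩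
    2 ^ (D + k ∸ 1)          ≤⟨ 2^[d+k∸1]≤k!*2^d D k ⟩
    k ! * 2 ^ D              ≤⟨ k!*2^D≤m ⟩
    m n                      ∎
    where open ≤-Reasoning

lemma6 : ((k : ℕ) (n : Fin k → ℕ) → (∀ i → NonZero (n i)) → (∀ i j → i ≢ j → ¬ (n i ∣ n j))
           → m (prodFin k n) ≥ (k !) * prodFin k (λ i → m (n i)))
         × ((n : ℕ) → .{{_ : NonZero n}}
           → (m n ≥ (ω n !) * 2 ^ (Ω n ∸ ω n)) × (m n ≥ 2 ^ (Ω n ∸ 1)))
lemma6 = incomparable⇒m-prodFin≥k!*prodFin-m , λ n → m≥ω!*2^[Ω∸ω] n , m≥2^[Ω∸1] n
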